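{- For every finite simple graph $G$, $\mathsf{in}_t(G)\le|V(G)|+2$.
   Context: Zero-visibility $k$-search game on a finite simple graph $G$: an invisible intruder occupies a vertex; players alternate starting with the searcher; on each turn the searcher inspects an arbitrary set of $k$ vertices and wins if the intruder is at one of them; otherwise the intruder may move to an adjacent vertex or stay. The inspection number $\mathsf{in}(G)$ is the least $k$ for which the searcher has a finite sequence of moves guaranteeing capture. A subdivision of $G$ is obtained by repeatedly replacing an edge by a path of length two through a new vertex. $\mathsf{in}_t(G)$ is the least $k$ such that every subdivision $H$ of $G$ has a further subdivision $H'$ with $\mathsf{in}(H')\le k$. -}

module Defs where

open import Data.Nat using (ℕ; _≤_)
import Data.Nat as ℕ
open import Data.Fin using (Fin; zero; suc)
open import Data.Fin.Subset using (Subset; _∈_; ∣_∣)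
open import Data.List using (List; []; _∷_)
open import Data.List.Relation.Unary.All using (All)
open import Data.Product using (Σ; _×_; _,_; ∃; ∃-syntax)
open import Data.Sum using (_⊎_; inj₁; inj₂)
open import Data.Empty using (⊥)
open import Relation.Nullary using (¬_)
open import Relation.Binary.PropositionalEquality using (_≡_)

record Graph : Set₁ where
  field
    n     : ℕ
    Adj   : Fin n → Fin n → Set
    sym   : ∀ {u v} → Adj u v → Adj v u
    irrefl : ∀ {u} → ¬ Adj u u
open Graph public

∣V∣ : Graph → ℕ
∣V∣ G = n G

-- Elementary subdivision of the edge {u,v}: new vertex is 'zero',
-- old vertex i becomes 'suc i'; the edge uv is removed and replaced
-- by the path u - zero - v.
module _ (G : Graph) (u v : Fin (n G)) where
  private
    IsUV : Fin (n G) → Fin (n G) → Set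
    IsUV i j = (i ≡ u × j ≡ v) ⊎ (i ≡ v × j ≡ u)

    swapUV : ∀ {i j} → IsUV i j → IsUV j i
    swapUV (inj₁ (a , b)) = inj₂ (b , a)
    swapUV (inj₂ (a , b)) = inj₁ (b , a)

    A' : Fin (ℕ.suc (n G)) → Fin (ℕ.suc (n G)) → Set
    A' zero zero = ⊥
    A' zero (suc i) = i ≡ u ⊎ i ≡ v
    A' (suc i) zero = i ≡ u ⊎ i ≡ v
    A' (suc i) (suc j) = Adj G i j × ¬ IsUV i j

    s' : ∀ {a b} → A' a b → A' b a
    s' {zero} {zero} ()
    s' {zero} {suc j} p = p
    s' {suc i} {zero} p = p
    s' {suc i} {suc j} (e , q) = sym G e , λ r → q (swapUV r)

    i' : ∀ {a} → ¬ A' a a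
    i' {zero} ()
    i' {suc i} (e , _) = irrefl G e

  subdivideEdge : Adj G u v → Graph
  subdivideEdge _ = record { n = ℕ.suc (n G) ; Adj = A' ; sym = s' ; irrefl = i' }

data Subdivision (G : Graph) : Graph → Set₁ where
  done : Subdivision G G
  step : ∀ {H} (u v : Fin (n G)) (e : Adj G u v) →
         Subdivision (subdivideEdge G u v e) H → Subdivision G H

-- Zero-visibility search: a searcher strategy is a finite list of
-- inspected sets.  'Caught G Ss x' : an intruder currently at x, facing
-- the remaining inspections Ss, is caught whatever it does.
Caught : (G : Graph) → List (Subset (n G)) → Fin (n G) → Set
Caught G [] x = ⊥
Caught G (S ∷ Ss) x = x ∈ S ⊎ (∀ y → (y ≡ x ⊎ Adj G x y) → Caught G Ss y)

Winning : (G : Graph) → ℕ → List (Subset (n G)) → Set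
Winning G k Ss = All (λ S → ∣ S ∣ ≤ k) Ss × (∀ x → Caught G Ss x)

SearcherWins : Graph → ℕ → Set
SearcherWins G k = ∃[ Ss ] Winning G k Ss

-- in(G) ≤ k  (in(G) is the least j such that the searcher wins the j-search game)
InspLe : Graph → ℕ → Set
InspLe G k = ∃[ j ] (j ≤ k × SearcherWins G j)

-- in_t(G) ≤ k (in_t(G) is the least j with the property below; the property
-- is monotone in j, so in_t(G) ≤ k iff it holds for k)
InspTLe : Graph → ℕ → Set₁
InspTLe G k = ∀ H → Subdivision G H → Σ Graph (λ H' → Subdivision H H' × InspLe H' k)

-- No further subdivision is needed: H' = H.  Keep the |V(G)| original vertices of G
-- permanently inspected.  The other vertices of H are internal vertices of the paths
-- replacing the edges of G; they can be listed in one sequence (their rank) in which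
-- adjacent internal vertices have consecutive ranks.  In round i the searcher also
-- inspects the vertices of ranks i and i + 1; an intruder on an internal vertex that
-- survives round i has rank at least i + 2, so after its move it has rank at least
-- i + 1 or sits on an inspected original vertex, and the sweep eventually reaches it.
-- Such a ranking exists for G itself (no internal vertices) and survives subdividing
-- an edge, by inserting the new vertex into the sequence at a suitable position.
module Submission where

open import Defs
open import Data.Nat using (ℕ; zero; suc; _+_; _≤_; _<_; z≤n; s≤s; _<?_; _≟_)
import Data.Nat.Properties as ℕₚ
open import Data.Fin using (Fin; zero; suc)
import Data.Fin.Properties as Finₚ
open import Data.Fin.Subset using (Subset; _∈_; _∉_; ∣_∣; _∪_; ⁅_⁆; ⊤; inside; outside)
  renaming (⊥ to ∅)
open import Data.Fin.Subset.Properties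
  using (_∈?_; ∈⊤; ∣⊤∣≡n; ∣⊥∣≡0; ∣⁅x⁆∣≡1; x∈⁅x⁆; p⊆p∪q; q⊆p∪q)
open import Data.Vec.Base using (_∷_; []; there)
open import Data.List using (List; []; _∷_)
open import Data.List.Relation.Unary.All using (All; []; _∷_)
open import Data.Product using (_×_; _,_; proj₁; proj₂; ∃; ∃₂)
open import Data.Sum using (_⊎_; inj₁; inj₂)
import Data.Sum as Sum
open import Data.Empty using (⊥; ⊥-elim)
open import Function using (_∘_; id)
open import Relation.Nullary using (¬_; Dec; yes; no; contradiction)
open import Relation.Nullary.Decidable using (_×-dec_; ¬?)
open import Relation.Binary.Definitions using (tri<; tri≈; tri>)
open import Relation.Binary.PropositionalEquality as ≡ using (_≡_; _≢_; refl; cong)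

∣p∪q∣≤∣p∣+∣q∣ : ∀ {m} (p q : Subset m) → ∣ p ∪ q ∣ ≤ ∣ p ∣ + ∣ q ∣
∣p∪q∣≤∣p∣+∣q∣ []            []            = z≤n
∣p∪q∣≤∣p∣+∣q∣ (outside ∷ p) (outside ∷ q) = ∣p∪q∣≤∣p∣+∣q∣ p q
∣p∪q∣≤∣p∣+∣q∣ (outside ∷ p) (inside  ∷ q) =
  ℕₚ.≤-trans (s≤s (∣p∪q∣≤∣p∣+∣q∣ p q)) (ℕₚ.≤-reflexive (≡.sym (ℕₚ.+-suc ∣ p ∣ ∣ q ∣)))
∣p∪q∣≤∣p∣+∣q∣ (inside  ∷ p) (outside ∷ q) = s≤s (∣p∪q∣≤∣p∣+∣q∣ p q)
∣p∪q∣≤∣p∣+∣q∣ (inside  ∷ p) (inside  ∷ q) =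
  s≤s (ℕₚ.≤-trans (∣p∪q∣≤∣p∣+∣q∣ p q) (ℕₚ.+-monoʳ-≤ ∣ p ∣ (ℕₚ.n≤1+n ∣ q ∣)))

module _ {m} {P : Fin m → Set} where

  witnessSet : Dec (∃ P) → Subset m
  witnessSet (yes (x , _)) = ⁅ x ⁆
  witnessSet (no _)        = ∅

  ∣witnessSet∣≤1 : ∀ d → ∣ witnessSet d ∣ ≤ 1
  ∣witnessSet∣≤1 (yes (x , _)) = ℕₚ.≤-reflexive (∣⁅x⁆∣≡1 x)
  ∣witnessSet∣≤1 (no _)        = ℕₚ.≤-trans (ℕₚ.≤-reflexive (∣⊥∣≡0 m)) z≤n

  ∈witnessSet : (∀ {x y} → P x → P y → x ≡ y) → ∀ d {y} → P y → y ∈ witnessSet d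
  ∈witnessSet unique (yes (x , px)) py = ≡.subst (_∈ ⁅ x ⁆) (unique px py) (x∈⁅x⁆ x)
  ∈witnessSet unique (no ¬∃P)       py = contradiction (_ , py) ¬∃P

otherThan : ∀ {A : Set} {P : A → Set} {a b w : A} → (∀ {y} → P y → y ≡ a ⊎ y ≡ b) →
            w ≡ a ⊎ w ≡ b → ∃ λ c → ∀ {y} → P y → y ≢ w → y ≡ c
otherThan {b = b} cover (inj₁ refl) = b , λ py y≢a → Sum.[ ⊥-elim ∘ y≢a , id ] (cover py)
otherThan {a = a} cover (inj₂ refl) = a , λ py y≢b → Sum.[ id , ⊥-elim ∘ y≢b ] (cover py)

punchIn : ℕ → ℕ → ℕ
punchIn p a with a <? p
... | yes _ = a
... | no _  = suc a

punchIn-< : ∀ {p a} → a < p → punchIn p a ≡ a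
punchIn-< {p} {a} a<p with a <? p
... | yes _   = refl
... | no a≮p  = contradiction a<p a≮p

punchIn-≥ : ∀ {p a} → p ≤ a → punchIn p a ≡ suc a
punchIn-≥ {p} {a} p≤a with a <? p
... | yes a<p = contradiction p≤a (ℕₚ.<⇒≱ a<p)
... | no _    = refl

punchIn≤1+ : ∀ p a → punchIn p a ≤ suc a
punchIn≤1+ p a with a <? p
... | yes _ = ℕₚ.n≤1+n a
... | no _  = ℕₚ.≤-refl

punchInₚ≢p : ∀ p a → punchIn p a ≢ p
punchInₚ≢p p a with a <? p
... | yes a<p = ℕₚ.<⇒≢ a<p
... | no a≮p  = λ 1+a≡p → a≮p (ℕₚ.≤-reflexive 1+a≡p)

punchIn-injective : ∀ p {a b} → punchIn p a ≡ punchIn p b → a ≡ b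
punchIn-injective p {a} {b} eq with a <? p | b <? p
... | yes _   | yes _   = eq
... | yes a<p | no b≮p  = contradiction (≡.subst (_< p) eq a<p) (b≮p ∘ ℕₚ.<-trans (ℕₚ.n<1+n b))
... | no a≮p  | yes b<p = contradiction (≡.subst (_< p) (≡.sym eq) b<p) (a≮p ∘ ℕₚ.<-trans (ℕₚ.n<1+n a))
... | no _    | no _    = ℕₚ.suc-injective eq

punchIn-step : ∀ p {a b} → b ≤ suc a → (suc a ≡ p → b ≡ p → ⊥) →
               punchIn p b ≤ suc (punchIn p a)
punchIn-step p {a} {b} b≤1+a crossing with a <? p | b <? p
... | yes _   | yes _   = b≤1+a
... | yes a<p | no b≮p  = ⊥-elim (crossing 1+a≡p b≡p)
  where
  b≡p : b ≡ p
  b≡p = ℕₚ.≤-antisym (ℕₚ.≤-trans b≤1+a a<p) (ℕₚ.≮⇒≥ b≮p)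
  1+a≡p : suc a ≡ p
  1+a≡p = ℕₚ.≤-antisym a<p (ℕₚ.≤-trans (ℕₚ.≮⇒≥ b≮p) b≤1+a)
... | no a≮p  | yes b<p = ℕₚ.m≤n⇒m≤1+n (ℕₚ.m≤n⇒m≤1+n (ℕₚ.≤-trans (ℕₚ.<⇒≤ b<p) (ℕₚ.≮⇒≥ a≮p)))
... | no _    | no _    = s≤s b≤1+a

punchIn-near : ∀ {p a} → a ≡ p ⊎ suc a ≡ p → punchIn p a ≤ suc p × p ≤ suc (punchIn p a)
punchIn-near {a = a} (inj₁ refl) rewrite punchIn-≥ (ℕₚ.≤-refl {a}) =
  ℕₚ.≤-refl , ℕₚ.m≤n⇒m≤1+n (ℕₚ.n≤1+n a)
punchIn-near {a = a} (inj₂ refl) rewrite punchIn-< (ℕₚ.≤-refl {suc a}) =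
  ℕₚ.m≤n⇒m≤1+n (ℕₚ.n≤1+n a) , ℕₚ.≤-refl

AtMostTwoNeighbours : (H : Graph) → Fin (n H) → Set
AtMostTwoNeighbours H x = ∃₂ λ a b → ∀ {y} → Adj H x y → y ≡ a ⊎ y ≡ b

record SweepOrder (k : ℕ) (H : Graph) : Set where
  field
    guarded        : Subset (n H)
    ∣guarded∣≤k    : ∣ guarded ∣ ≤ k
    rank           : Fin (n H) → ℕ
    maxRank        : ℕ
    rank≤maxRank   : ∀ {x} → x ∉ guarded → rank x ≤ maxRank
    rank-injective : ∀ {x y} → x ∉ guarded → y ∉ guarded → rank x ≡ rank y → x ≡ y
    rank-adjacent  : ∀ {x y} → x ∉ guarded → y ∉ guarded → Adj H x y → rank y ≤ suc (rank x)
    twoNeighbours  : ∀ {x} → x ∉ guarded → AtMostTwoNeighbours H x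

  adjacent-ranks : ∀ {x y} → x ∉ guarded → y ∉ guarded → Adj H x y →
                   rank y ≡ suc (rank x) ⊎ rank x ≡ suc (rank y)
  adjacent-ranks {x} {y} x∉ y∉ xy with ℕₚ.<-cmp (rank x) (rank y)
  ... | tri< x<y _ _ = inj₁ (ℕₚ.≤-antisym (rank-adjacent x∉ y∉ xy) x<y)
  ... | tri≈ _ x≈y _ = ⊥-elim (irrefl H (≡.subst (Adj H x) (≡.sym (rank-injective x∉ y∉ x≈y)) xy))
  ... | tri> _ _ y<x = inj₂ (ℕₚ.≤-antisym (rank-adjacent y∉ x∉ (sym H xy)) y<x)

guardAll : (G : Graph) → SweepOrder (n G) G
guardAll G = record
  { guarded        = ⊤
  ; ∣guarded∣≤k    = ℕₚ.≤-reflexive (∣⊤∣≡n (n G))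
  ; rank           = λ _ → 0
  ; maxRank        = 0
  ; rank≤maxRank   = λ x∉ → contradiction ∈⊤ x∉
  ; rank-injective = λ x∉ _ _ → contradiction ∈⊤ x∉
  ; rank-adjacent  = λ x∉ _ _ → contradiction ∈⊤ x∉
  ; twoNeighbours  = λ x∉ → contradiction ∈⊤ x∉
  }

module Sweep {k : ℕ} {H : Graph} (σ : SweepOrder k H) where
  open SweepOrder σ

  AtRank : ℕ → Fin (n H) → Set
  AtRank i x = x ∉ guarded × rank x ≡ i

  atRank? : ∀ i → Dec (∃ (AtRank i))
  atRank? i = Finₚ.any? λ x → ¬? (x ∈? guarded) ×-dec (rank x ≟ i)

  atRank : ℕ → Subset (n H)
  atRank i = witnessSet (atRank? i)

  ∈atRank : ∀ {i y} → AtRank i y → y ∈ atRank i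
  ∈atRank = ∈witnessSet (λ (x∉ , rx≡i) (y∉ , ry≡i) → rank-injective x∉ y∉ (≡.trans rx≡i (≡.sym ry≡i)))
                         (atRank? _)

  sweep : ℕ → Subset (n H)
  sweep i = guarded ∪ (atRank i ∪ atRank (suc i))

  ∣sweep∣≤k+2 : ∀ i → ∣ sweep i ∣ ≤ k + 2
  ∣sweep∣≤k+2 i = ℕₚ.≤-trans (∣p∪q∣≤∣p∣+∣q∣ guarded _) (ℕₚ.+-mono-≤ ∣guarded∣≤k
    (ℕₚ.≤-trans (∣p∪q∣≤∣p∣+∣q∣ (atRank i) _)
                (ℕₚ.+-mono-≤ (∣witnessSet∣≤1 (atRank? i)) (∣witnessSet∣≤1 (atRank? (suc i))))))

  Ahead : ℕ → Fin (n H) → Set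
  Ahead i y = y ∈ guarded ⊎ i ≤ rank y

  inspected-or-escaped : ∀ {i y} → Ahead i y → y ∈ sweep i ⊎ (y ∉ guarded × suc (suc i) ≤ rank y)
  inspected-or-escaped {i} {y} ahead with y ∈? guarded
  ... | yes y∈ = inj₁ (p⊆p∪q _ y∈)
  ... | no y∉ with ahead
  ... | inj₁ y∈ = contradiction y∈ y∉
  ... | inj₂ i≤r with rank y ≟ i
  ... | yes r≡i = inj₁ (q⊆p∪q guarded _ (p⊆p∪q _ (∈atRank (y∉ , r≡i))))
  ... | no r≢i with rank y ≟ suc i
  ... | yes r≡1+i = inj₁ (q⊆p∪q guarded _ (q⊆p∪q (atRank i) _ (∈atRank (y∉ , r≡1+i))))
  ... | no r≢1+i = inj₂ (y∉ , ℕₚ.≤∧≢⇒< (ℕₚ.≤∧≢⇒< i≤r (r≢i ∘ ≡.sym)) (r≢1+i ∘ ≡.sym))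

  escaped-stays-ahead : ∀ {i y y′} → y ∉ guarded → suc (suc i) ≤ rank y →
                        y′ ≡ y ⊎ Adj H y y′ → Ahead (suc i) y′
  escaped-stays-ahead {i} _ 2+i≤r (inj₁ refl) = inj₂ (ℕₚ.≤-trans (ℕₚ.n≤1+n (suc i)) 2+i≤r)
  escaped-stays-ahead {y′ = y′} y∉ 2+i≤r (inj₂ yy′) with y′ ∈? guarded
  ... | yes y′∈ = inj₁ y′∈
  ... | no y′∉  = inj₂ (ℕₚ.≤-pred (ℕₚ.≤-trans 2+i≤r (rank-adjacent y′∉ y∉ (sym H yy′))))

  sweeps : ℕ → ℕ → List (Subset (n H))
  sweeps i zero    = sweep i ∷ []
  sweeps i (suc m) = sweep i ∷ sweeps (suc i) m

  ∣sweeps∣≤k+2 : ∀ i m → All (λ S → ∣ S ∣ ≤ k + 2) (sweeps i m)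
  ∣sweeps∣≤k+2 i zero    = ∣sweep∣≤k+2 i ∷ []
  ∣sweeps∣≤k+2 i (suc m) = ∣sweep∣≤k+2 i ∷ ∣sweeps∣≤k+2 (suc i) m

  sweeps-catch : ∀ m i → maxRank ≤ m + i → ∀ {y} → Ahead i y → Caught H (sweeps i m) y
  sweeps-catch zero i max≤i ahead with inspected-or-escaped ahead
  ... | inj₁ inspected       = inj₁ inspected
  ... | inj₂ (y∉ , 2+i≤r) =
    contradiction (ℕₚ.≤-trans (rank≤maxRank y∉) max≤i) (ℕₚ.<⇒≱ (ℕₚ.<-trans (ℕₚ.n<1+n i) 2+i≤r))
  sweeps-catch (suc m) i max≤1+m+i ahead with inspected-or-escaped ahead
  ... | inj₁ inspected       = inj₁ inspected
  ... | inj₂ (y∉ , 2+i≤r) = inj₂ λ _ move →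
    sweeps-catch m (suc i) (≡.subst (maxRank ≤_) (≡.sym (ℕₚ.+-suc m i)) max≤1+m+i)
                 (escaped-stays-ahead y∉ 2+i≤r move)

  searcherWins : InspLe H (k + 2)
  searcherWins = k + 2 , ℕₚ.≤-refl , sweeps 0 maxRank , ∣sweeps∣≤k+2 0 maxRank ,
                 λ _ → sweeps-catch maxRank 0 (ℕₚ.m≤m+n maxRank 0) (inj₂ z≤n)

module Subdivide {k : ℕ} {H : Graph} (σ : SweepOrder k H) {u v : Fin (n H)} (uv : Adj H u v) where
  open SweepOrder σ

  H′ : Graph
  H′ = subdivideEdge H u v uv

  IsEndpoint : Fin (n H) → Set
  IsEndpoint w = w ≡ u ⊎ w ≡ v

  IsEdgeUV : Fin (n H) → Fin (n H) → Set
  IsEdgeUV x y = (x ≡ u × y ≡ v) ⊎ (x ≡ v × y ≡ u)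

  twoNeighbours-suc : ∀ {x} → AtMostTwoNeighbours H x → AtMostTwoNeighbours H′ (suc x)
  twoNeighbours-suc {x} (a , b , cover) with x Finₚ.≟ u | x Finₚ.≟ v
  ... | yes refl | _ with otherThan cover (cover uv)
  ...   | c , only-c = zero , suc c , cover′
    where
    cover′ : ∀ {y} → Adj H′ (suc u) y → y ≡ zero ⊎ y ≡ suc c
    cover′ {zero}  _          = inj₁ refl
    cover′ {suc y} (uy , ¬uv) = inj₂ (cong suc (only-c uy (λ y≡v → ¬uv (inj₁ (refl , y≡v)))))
  twoNeighbours-suc (_ , _ , cover) | no _ | yes refl with otherThan cover (cover (sym H uv))
  ...   | c , only-c = zero , suc c , cover′
    where
    cover′ : ∀ {y} → Adj H′ (suc v) y → y ≡ zero ⊎ y ≡ suc c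
    cover′ {zero}  _          = inj₁ refl
    cover′ {suc y} (vy , ¬uv) = inj₂ (cong suc (only-c vy (λ y≡u → ¬uv (inj₂ (refl , y≡u)))))
  twoNeighbours-suc {x} (a , b , cover) | no x≢u | no x≢v = suc a , suc b , cover′
    where
    cover′ : ∀ {y} → Adj H′ (suc x) y → y ≡ suc a ⊎ y ≡ suc b
    cover′ {zero}  (inj₁ x≡u) = contradiction x≡u x≢u
    cover′ {zero}  (inj₂ x≡v) = contradiction x≡v x≢v
    cover′ {suc y} (xy , _)   = Sum.map (cong suc) (cong suc) (cover xy)

  module InsertAt
    (p : ℕ) (p≤1+maxRank : p ≤ suc maxRank)
    (endpoint-near : ∀ {w} → w ∉ guarded → IsEndpoint w → rank w ≡ p ⊎ suc (rank w) ≡ p)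
    (no-crossing : ∀ {x y} → x ∉ guarded → y ∉ guarded → Adj H x y → ¬ IsEdgeUV x y →
                   suc (rank x) ≡ p → rank y ≡ p → ⊥)
    where

    guarded′ : Subset (suc (n H))
    guarded′ = outside ∷ guarded

    rank′ : Fin (suc (n H)) → ℕ
    rank′ zero    = p
    rank′ (suc x) = punchIn p (rank x)

    rank′≤1+maxRank : ∀ {x} → x ∉ guarded′ → rank′ x ≤ suc maxRank
    rank′≤1+maxRank {zero}  _  = p≤1+maxRank
    rank′≤1+maxRank {suc x} x∉ =
      ℕₚ.≤-trans (punchIn≤1+ p (rank x)) (s≤s (rank≤maxRank (x∉ ∘ there)))

    rank′-injective : ∀ {x y} → x ∉ guarded′ → y ∉ guarded′ → rank′ x ≡ rank′ y → x ≡ y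
    rank′-injective {zero}  {zero}  _  _  _  = refl
    rank′-injective {zero}  {suc y} _  _  eq = contradiction (≡.sym eq) (punchInₚ≢p p (rank y))
    rank′-injective {suc x} {zero}  _  _  eq = contradiction eq (punchInₚ≢p p (rank x))
    rank′-injective {suc x} {suc y} x∉ y∉ eq =
      cong suc (rank-injective (x∉ ∘ there) (y∉ ∘ there) (punchIn-injective p eq))

    rank′-adjacent : ∀ {x y} → x ∉ guarded′ → y ∉ guarded′ → Adj H′ x y → rank′ y ≤ suc (rank′ x)
    rank′-adjacent {zero}  {zero}  _  _  ()
    rank′-adjacent {zero}  {suc y} _  y∉ y-end =
      proj₁ (punchIn-near (endpoint-near (y∉ ∘ there) y-end))
    rank′-adjacent {suc x} {zero}  x∉ _  x-end =
      proj₂ (punchIn-near (endpoint-near (x∉ ∘ there) x-end))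
    rank′-adjacent {suc x} {suc y} x∉ y∉ (xy , ¬uv) =
      punchIn-step p (rank-adjacent (x∉ ∘ there) (y∉ ∘ there) xy)
                     (no-crossing (x∉ ∘ there) (y∉ ∘ there) xy ¬uv)

    twoNeighbours′ : ∀ {x} → x ∉ guarded′ → AtMostTwoNeighbours H′ x
    twoNeighbours′ {zero}  _  = suc u , suc v , cover′
      where
      cover′ : ∀ {y} → Adj H′ zero y → y ≡ suc u ⊎ y ≡ suc v
      cover′ {suc y} = Sum.map (cong suc) (cong suc)
    twoNeighbours′ {suc x} x∉ = twoNeighbours-suc (twoNeighbours (x∉ ∘ there))

    sweepOrder : SweepOrder k H′
    sweepOrder = record
      { guarded        = guarded′
      ; ∣guarded∣≤k    = ∣guarded∣≤k
      ; rank           = rank′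
      ; maxRank        = suc maxRank
      ; rank≤maxRank   = rank′≤1+maxRank
      ; rank-injective = rank′-injective
      ; rank-adjacent  = rank′-adjacent
      ; twoNeighbours  = twoNeighbours′
      }

  bothGuarded : u ∈ guarded → v ∈ guarded → SweepOrder k H′
  bothGuarded u∈ v∈ = InsertAt.sweepOrder 0 z≤n endpoint-near (λ _ _ _ _ ())
    where
    endpoint-near : ∀ {w} → w ∉ guarded → IsEndpoint w → rank w ≡ 0 ⊎ suc (rank w) ≡ 0
    endpoint-near w∉ (inj₁ refl) = contradiction u∈ w∉
    endpoint-near w∉ (inj₂ refl) = contradiction v∈ w∉

  -- Besides t, s has a single neighbour c, so one of the two slots next to s in the
  -- order (just below or just above it) is free for the new vertex.
  oneGuarded : ∀ {s t} → s ∉ guarded → t ∈ guarded → Adj H s t →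
               (∀ {w} → w ∉ guarded → IsEndpoint w → w ≡ s) → SweepOrder k H′
  oneGuarded {s} {t} s∉ t∈ st only-s with twoNeighbours s∉
  ... | _ , _ , cover with otherThan cover (cover st)
  ... | c , only-c with ¬? (c ∈? guarded) ×-dec (suc (rank c) ≟ rank s)
  ... | yes (c∉ , 1+rc≡rs) =
    InsertAt.sweepOrder (suc (rank s)) (s≤s (rank≤maxRank s∉)) endpoint-near no-crossing
    where
    endpoint-near : ∀ {w} → w ∉ guarded → IsEndpoint w → rank w ≡ suc (rank s) ⊎ suc (rank w) ≡ suc (rank s)
    endpoint-near w∉ w-end rewrite only-s w∉ w-end = inj₂ refl
    no-crossing : ∀ {x y} → x ∉ guarded → y ∉ guarded → Adj H x y → ¬ IsEdgeUV x y →
                  suc (rank x) ≡ suc (rank s) → rank y ≡ suc (rank s) → ⊥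
    no-crossing x∉ y∉ xy _ 1+rx≡1+rs ry≡1+rs
      with rank-injective x∉ s∉ (ℕₚ.suc-injective 1+rx≡1+rs)
    ... | refl with only-c xy (λ { refl → y∉ t∈ })
    ... | refl = ℕₚ.m≢1+n+m (rank s) (≡.trans (≡.sym 1+rc≡rs) (cong suc ry≡1+rs))
  ... | no ¬c-below =
    InsertAt.sweepOrder (rank s) (ℕₚ.m≤n⇒m≤1+n (rank≤maxRank s∉)) endpoint-near no-crossing
    where
    endpoint-near : ∀ {w} → w ∉ guarded → IsEndpoint w → rank w ≡ rank s ⊎ suc (rank w) ≡ rank s
    endpoint-near w∉ w-end rewrite only-s w∉ w-end = inj₁ refl
    no-crossing : ∀ {x y} → x ∉ guarded → y ∉ guarded → Adj H x y → ¬ IsEdgeUV x y →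
                  suc (rank x) ≡ rank s → rank y ≡ rank s → ⊥
    no-crossing x∉ y∉ xy _ 1+rx≡rs ry≡rs with rank-injective y∉ s∉ ry≡rs
    ... | refl with only-c (sym H xy) (λ { refl → x∉ t∈ })
    ... | refl = ¬c-below (x∉ , 1+rx≡rs)

  consecutive : ∀ {s t} → s ∉ guarded → t ∉ guarded → rank t ≡ suc (rank s) →
                (∀ {w} → IsEndpoint w → w ≡ s ⊎ w ≡ t) → IsEdgeUV s t → SweepOrder k H′
  consecutive {s} {t} s∉ t∉ rt≡1+rs endpoint-st st-is-uv =
    InsertAt.sweepOrder (rank t) (ℕₚ.m≤n⇒m≤1+n (rank≤maxRank t∉)) endpoint-near no-crossing
    where
    endpoint-near : ∀ {w} → w ∉ guarded → IsEndpoint w → rank w ≡ rank t ⊎ suc (rank w) ≡ rank t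
    endpoint-near _ w-end with endpoint-st w-end
    ... | inj₁ refl = inj₂ (≡.sym rt≡1+rs)
    ... | inj₂ refl = inj₁ refl
    no-crossing : ∀ {x y} → x ∉ guarded → y ∉ guarded → Adj H x y → ¬ IsEdgeUV x y →
                  suc (rank x) ≡ rank t → rank y ≡ rank t → ⊥
    no-crossing x∉ y∉ _ ¬uv 1+rx≡rt ry≡rt
      with rank-injective x∉ s∉ (ℕₚ.suc-injective (≡.trans 1+rx≡rt rt≡1+rs))
         | rank-injective y∉ t∉ ry≡rt
    ... | refl | refl = ¬uv st-is-uv

  sweepOrder : SweepOrder k H′
  sweepOrder with u ∈? guarded | v ∈? guarded
  ... | yes u∈ | yes v∈ = bothGuarded u∈ v∈
  ... | yes u∈ | no v∉  = oneGuarded v∉ u∈ (sym H uv) λ where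
    w∉ (inj₁ refl) → contradiction u∈ w∉
    _  (inj₂ w≡v)  → w≡v
  ... | no u∉  | yes v∈ = oneGuarded u∉ v∈ uv λ where
    _  (inj₁ w≡u)  → w≡u
    w∉ (inj₂ refl) → contradiction v∈ w∉
  ... | no u∉  | no v∉  with adjacent-ranks u∉ v∉ uv
  ... | inj₁ rv≡1+ru = consecutive u∉ v∉ rv≡1+ru id (inj₁ (refl , refl))
  ... | inj₂ ru≡1+rv = consecutive v∉ u∉ ru≡1+rv Sum.swap (inj₂ (refl , refl))

sweepOrder-subdivision : ∀ {k G H} → SweepOrder k G → Subdivision G H → SweepOrder k H
sweepOrder-subdivision σ done              = σ
sweepOrder-subdivision σ (step _ _ uv sub) = sweepOrder-subdivision (Subdivide.sweepOrder σ uv) sub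

proposition5p4 : (G : Graph) → InspTLe G (∣V∣ G + 2)
proposition5p4 G H G⇝H = H , done , Sweep.searcherWins (sweepOrder-subdivision (guardAll G) G⇝H)
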